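{- Let $m\geq 3$ be an integer and let $\varphi$ be an arbitrary proper edge-coloring of the complete graph $K_{2m}$ with $2m-1$ colors. Then $K_{2m}$ contains two edge-disjoint, isomorphic, multicolored spanning trees.
   Context: An edge-coloring is proper if any two edges sharing a vertex receive distinct colors. A subgraph of an edge-colored graph is multicolored if no two of its edges have the same color. A spanning tree of $K_{2m}$ is a subgraph that is a tree and contains all $2m$ vertices. -}

module Defs where

open import Data.Nat using (ℕ; suc)
open import Data.Fin using (Fin; zero; suc; inject₁; fromℕ)
open import Data.Bool using (Bool; true; false)
open import Data.Product using (_×_; Σ)
open import Data.Sum using (_⊎_)
open import Data.Empty using (⊥)
open import Relation.Nullary using (¬_)
open import Relation.Binary.PropositionalEquality using (_≡_; _≢_)
open import Relation.Binary.Construct.Closure.ReflexiveTransitive using (Star)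
open import Function.Definitions using (Injective)
open import Data.Fin.Permutation using (Permutation′; _⟨$⟩ʳ_)

-- An edge-coloring of the complete graph K_n with k colors:
-- the color of edge {u,v} is c u v (values on the diagonal are irrelevant).
record EdgeColoring (n k : ℕ) : Set where
  field
    col  : Fin n → Fin n → Fin k
    symm : ∀ u v → col u v ≡ col v u

open EdgeColoring public

Proper : ∀ {n k} → EdgeColoring n k → Set
Proper {n} c = ∀ (u v w : Fin n) → u ≢ v → u ≢ w → v ≢ w → col c u v ≢ col c u w

record Subgraph (n : ℕ) : Set where
  field
    adj     : Fin n → Fin n → Bool
    adj-sym : ∀ u v → adj u v ≡ adj v u
    adj-irr : ∀ u → adj u u ≡ false

open Subgraph public

Edge : ∀ {n} → Subgraph n → Fin n → Fin n → Set
Edge G u v = adj G u v ≡ true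

Connected : ∀ {n} → Subgraph n → Set
Connected {n} G = ∀ (u v : Fin n) → Star (Edge G) u v

-- a cycle of length k+3: injective vertex sequence f 0, ..., f (k+2),
-- consecutive vertices adjacent, and the last adjacent to the first
record Cycle {n : ℕ} (G : Subgraph n) : Set where
  field
    len  : ℕ
    vert : Fin (suc (suc (suc len))) → Fin n
    inj  : Injective _≡_ _≡_ vert
    step : ∀ (i : Fin (suc (suc len))) → Edge G (vert (inject₁ i)) (vert (suc i))
    close : Edge G (vert (fromℕ (suc (suc len)))) (vert zero)

Acyclic : ∀ {n} → Subgraph n → Set
Acyclic G = ¬ Cycle G

IsSpanningTree : ∀ {n} → Subgraph n → Set
IsSpanningTree G = Connected G × Acyclic G

Multicolored : ∀ {n k} → EdgeColoring n k → Subgraph n → Set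
Multicolored {n} c G = ∀ (u v x y : Fin n) → Edge G u v → Edge G x y →
  col c u v ≡ col c x y → (u ≡ x × v ≡ y) ⊎ (u ≡ y × v ≡ x)

EdgeDisjoint : ∀ {n} → Subgraph n → Subgraph n → Set
EdgeDisjoint {n} G H = ∀ (u v : Fin n) → Edge G u v → adj H u v ≡ false

Isomorphic : ∀ {n} → Subgraph n → Subgraph n → Set
Isomorphic {n} G H = Σ (Permutation′ n) λ σ →
  ∀ (u v : Fin n) → adj G u v ≡ adj H (σ ⟨$⟩ʳ u) (σ ⟨$⟩ʳ v)

module Submission where

-- All trees we build are "hooked stars": a star centred at r in which two leaves q₁, q₂
-- are re-hung from the star onto vertices p₁, p₂ with  colour(q₁p₁) = colour(rq₂)  and
-- colour(q₂p₂) = colour(rq₁).  Such a tree uses exactly the colours of the star at r, so it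
-- is multicoloured whenever the colouring is proper.
--
-- For K_{K+1} with K colours every colour class is a perfect matching, so each vertex v has
-- a mate in every colour. A corner q – p – s "closes" if it extends to a square whose
-- opposite edges have equal colours. An open corner yields two disjoint hooked stars centred
-- at p and q; if the three corners at u spanned by u, w, a, b, c all close, a second explicit
-- pair works. Five vertices always suffice, which gives the theorem for m ≥ 3.

open import Defs
open import Data.Nat using (ℕ; suc; _*_; _∸_; _≥_; _≤_; s≤s)
open import Data.Nat.Properties using (≤-trans; n≤1+n; n<1+n; *-monoʳ-≤)
open import Data.Fin using (Fin; zero; suc; inject₁; fromℕ; inject≤; _≟_)
open import Data.Fin.Properties using (any?; <⇒notInjective; inject≤-injective; suc-injective)
open import Data.Fin.Patterns using (0F; 1F; 2F; 3F; 4F)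
open import Data.Fin.Relation.Unary.Top using (view; ‵fromℕ; ‵inj₁)
open import Data.Fin.Permutation using (Permutation′; _⟨$⟩ʳ_; _⟨$⟩ˡ_; inverseˡ; transpose; _∘ₚ_)
open import Data.Bool using (Bool; true; false; _∨_)
open import Data.Bool.Properties using (∨-comm; ∨-zeroʳ; ¬-not; ⇔→≡)
open import Data.Product using (Σ; ∃; _×_; _,_; proj₁; proj₂)
open import Data.Sum using (_⊎_; inj₁; inj₂; [_,_])
open import Data.Empty using (⊥; ⊥-elim)
open import Function using (_∘_)
open import Function.Definitions using (Injective)
open import Function.Bundles using (mk⇔)
open import Relation.Nullary using (¬_; Dec; yes; no; does; contradiction)
open import Relation.Nullary.Decidable using (¬?; _×-dec_; dec-true)
open import Relation.Binary.PropositionalEquality using (_≡_; _≢_; refl; sym; trans; cong; ≢-sym)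
open import Relation.Binary.Construct.Closure.ReflexiveTransitive
  using (Star; ε; _◅_; _◅◅_; reverse) renaming (map to map-walk)

does-sound : ∀ {A : Set} (a? : Dec A) → does a? ≡ true → A
does-sound (yes a) _ = a
does-sound (no _) ()

permutation-injective : ∀ {n} (σ : Permutation′ n) {x y : Fin n} → σ ⟨$⟩ʳ x ≡ σ ⟨$⟩ʳ y → x ≡ y
permutation-injective σ e = trans (sym (inverseˡ σ)) (trans (cong (σ ⟨$⟩ˡ_) e) (inverseˡ σ))

transpose-left : ∀ {n} (i j : Fin n) → transpose i j ⟨$⟩ʳ i ≡ j
transpose-left i j with i ≟ i
... | yes _ = refl
... | no i≢i = contradiction refl i≢i

transpose-right : ∀ {n} (i j : Fin n) → transpose i j ⟨$⟩ʳ j ≡ i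
transpose-right i j with j ≟ i
... | yes j≡i = j≡i
... | no _ with j ≟ j
...   | yes _ = refl
...   | no j≢j = contradiction refl j≢j

transpose-fixes : ∀ {n} {i j k : Fin n} → k ≢ i → k ≢ j → transpose i j ⟨$⟩ʳ k ≡ k
transpose-fixes {i = i} {j} {k} k≢i k≢j with k ≟ i
... | yes k≡i = contradiction k≡i k≢i
... | no _ with k ≟ j
...   | yes k≡j = contradiction k≡j k≢j
...   | no _ = refl

data SamePair {A : Set} (x y a b : A) : Set where
  straight : x ≡ a → y ≡ b → SamePair x y a b
  crossed  : x ≡ b → y ≡ a → SamePair x y a b

same-pair-sym : ∀ {A : Set} {x y a b : A} → SamePair x y a b → SamePair y x a b
same-pair-sym (straight e f) = crossed f e
same-pair-sym (crossed e f) = straight f e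

-- An unordered pair {x , y} cannot equal two pairs {a , b}, {c , d} that differ in both
-- matchings; this is how two specific edges are shown to be different.
pair-clash : ∀ {A : Set} {x y a b c d : A} → SamePair x y a b → SamePair x y c d →
             (a ≡ c → b ≢ d) → (a ≡ d → b ≢ c) → ⊥
pair-clash (straight refl refl) (straight e f) not-straight not-crossed = not-straight e f
pair-clash (straight refl refl) (crossed e f)  not-straight not-crossed = not-crossed e f
pair-clash (crossed refl refl)  (straight e f) not-straight not-crossed = not-crossed f e
pair-clash (crossed refl refl)  (crossed e f)  not-straight not-crossed = not-straight f e

by-first : ∀ {A : Set} {a b c d : A} → a ≢ c → a ≡ c → b ≢ d
by-first a≢c a≡c _ = a≢c a≡c

by-second : ∀ {A : Set} {a b c d : A} → b ≢ d → a ≡ c → b ≢ d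
by-second b≢d _ = b≢d

edge-sym : ∀ {n} (G : Subgraph n) {x y : Fin n} → Edge G x y → Edge G y x
edge-sym G {x} {y} e = trans (adj-sym G y x) e

module _ {n : ℕ} {G : Subgraph n} (cy : Cycle G) where
  open Cycle cy

  private
    two-apart : ∀ {k} (j : Fin k) → inject₁ (inject₁ j) ≢ suc (suc j)
    two-apart zero ()
    two-apart (suc j) e = two-apart j (suc-injective e)

  cycle-neighbours : ∀ i → ∃ λ j → ∃ λ k →
    j ≢ k × Edge G (vert i) (vert j) × Edge G (vert i) (vert k)
  cycle-neighbours zero = fromℕ _ , suc zero , (λ ()) , edge-sym G close , step zero
  cycle-neighbours (suc i) with view i
  ... | ‵fromℕ = inject₁ (fromℕ _) , zero , (λ ()) , edge-sym G (step (fromℕ _)) , close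
  ... | ‵inj₁ {i = j} _ =
    inject₁ (inject₁ j) , suc (suc j) , two-apart j , edge-sym G (step (inject₁ j)) , step (suc j)

  not-pinned : ∀ i z → (∀ j → Edge G (vert i) (vert j) → vert j ≡ z) → ⊥
  not-pinned i z pinned with cycle-neighbours i
  ... | j , k , j≢k , to-j , to-k = j≢k (inj (trans (pinned j to-j) (sym (pinned k to-k))))

module ParentGraph {n : ℕ} (root : Fin n) (parent : Fin n → Fin n)
                   (parent-moves : ∀ x → x ≢ root → parent x ≢ x) where

  Hangs : Fin n → Fin n → Set
  Hangs x y = x ≢ root × parent x ≡ y

  hangs? : ∀ x y → Dec (Hangs x y)
  hangs? x y = ¬? (x ≟ root) ×-dec (parent x ≟ y)

  link : Fin n → Fin n → Bool
  link x y = does (hangs? x y)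

  link-sound : ∀ {x y} → link x y ≡ true → Hangs x y
  link-sound {x} {y} = does-sound (hangs? x y)

  link-complete : ∀ {x y} → Hangs x y → link x y ≡ true
  link-complete {x} {y} = dec-true (hangs? x y)

  no-self-link : ∀ x → link x x ≡ false
  no-self-link x = ¬-not λ h → parent-moves x (proj₁ (link-sound h)) (proj₂ (link-sound h))

  graph : Subgraph n
  graph = record
    { adj     = λ x y → link x y ∨ link y x
    ; adj-sym = λ x y → ∨-comm (link x y) (link y x)
    ; adj-irr = λ x → cong (λ b → b ∨ b) (no-self-link x)
    }

  edge-elim : ∀ {x y} → Edge graph x y → Hangs x y ⊎ Hangs y x
  edge-elim {x} {y} e with link x y in eq
  ... | true  = inj₁ (link-sound eq)
  ... | false = inj₂ (link-sound e)

  edge-up : ∀ {x y} → Hangs x y → Edge graph x y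
  edge-up hangs rewrite link-complete hangs = refl

  edge-down : ∀ {x y} → Hangs y x → Edge graph x y
  edge-down {x} hangs rewrite link-complete hangs = ∨-zeroʳ (link x _)

  connected : (∀ x → Star Hangs x root) → Connected graph
  connected climb x y = along (climb x) ◅◅ reverse (λ {a b} → edge-sym graph {a} {b}) (along (climb y))
    where
    along : ∀ {a b} → Star Hangs a b → Star (Edge graph) a b
    along = map-walk (λ {a} {b} → edge-up {a} {b})

  childless-neighbour : ∀ {x z} → (∀ y → parent y ≢ x) → Edge graph x z → z ≡ parent x
  childless-neighbour childless e with edge-elim e
  ... | inj₁ (_ , px≡z) = sym px≡z
  ... | inj₂ (_ , pz≡x) = contradiction pz≡x (childless _)

  multicoloured : ∀ {K} (φ : EdgeColoring n K) →
    (∀ {x y} → x ≢ root → y ≢ root → col φ x (parent x) ≡ col φ y (parent y) → x ≡ y) →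
    Multicolored φ graph
  multicoloured φ distinct u v x y e₁ e₂ same-colour with edge-elim {u} {v} e₁ | edge-elim {x} {y} e₂
  ... | inj₁ (u≢r , refl) | inj₁ (x≢r , refl)
    with refl ← distinct u≢r x≢r same-colour = inj₁ (refl , refl)
  ... | inj₁ (u≢r , refl) | inj₂ (y≢r , refl)
    with refl ← distinct u≢r y≢r (trans same-colour (symm φ _ y)) = inj₂ (refl , refl)
  ... | inj₂ (v≢r , refl) | inj₁ (x≢r , refl)
    with refl ← distinct v≢r x≢r (trans (symm φ v _) same-colour) = inj₂ (refl , refl)
  ... | inj₂ (v≢r , refl) | inj₂ (y≢r , refl)
    with refl ← distinct v≢r y≢r (trans (symm φ v _) (trans same-colour (symm φ _ y))) =
      inj₁ (refl , refl)

parent-graph-iso : ∀ {n} {r r′ : Fin n} {par par′ : Fin n → Fin n}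
  {moves : ∀ x → x ≢ r → par x ≢ x} {moves′ : ∀ x → x ≢ r′ → par′ x ≢ x}
  (σ : Permutation′ n) → σ ⟨$⟩ʳ r ≡ r′ →
  (∀ x → x ≢ r → par′ (σ ⟨$⟩ʳ x) ≡ σ ⟨$⟩ʳ par x) →
  Isomorphic (ParentGraph.graph r par moves) (ParentGraph.graph r′ par′ moves′)
parent-graph-iso {r = r} {r′} {par} {par′} {moves} {moves′} σ root↦root commutes =
  σ , λ u v → ⇔→≡ (mk⇔ forth back)
  where
  module S = ParentGraph r par moves
  module T = ParentGraph r′ par′ moves′
  σ-inj = permutation-injective σ

  non-root : ∀ {x} → σ ⟨$⟩ʳ x ≢ r′ → x ≢ r
  non-root σx≢r′ x≡r = σx≢r′ (trans (cong (σ ⟨$⟩ʳ_) x≡r) root↦root)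

  hangs-forth : ∀ {x y} → S.Hangs x y → T.Hangs (σ ⟨$⟩ʳ x) (σ ⟨$⟩ʳ y)
  hangs-forth {x} (x≢r , refl) = (λ e → x≢r (σ-inj (trans e (sym root↦root)))) , commutes x x≢r

  hangs-back : ∀ {x y} → T.Hangs (σ ⟨$⟩ʳ x) (σ ⟨$⟩ʳ y) → S.Hangs x y
  hangs-back {x} (σx≢r′ , e) = non-root σx≢r′ , σ-inj (trans (sym (commutes x (non-root σx≢r′))) e)

  forth : ∀ {u v} → Edge S.graph u v → Edge T.graph (σ ⟨$⟩ʳ u) (σ ⟨$⟩ʳ v)
  forth {u} {v} e with S.edge-elim {u} {v} e
  ... | inj₁ hangs = T.edge-up (hangs-forth hangs)
  ... | inj₂ hangs = T.edge-down {σ ⟨$⟩ʳ u} (hangs-forth hangs)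

  back : ∀ {u v} → Edge T.graph (σ ⟨$⟩ʳ u) (σ ⟨$⟩ʳ v) → Edge S.graph u v
  back {u} {v} e with T.edge-elim {σ ⟨$⟩ʳ u} {σ ⟨$⟩ʳ v} e
  ... | inj₁ hangs = S.edge-up (hangs-back hangs)
  ... | inj₂ hangs = S.edge-down {u} (hangs-back hangs)

TwinTrees : ∀ {n K} → EdgeColoring n K → Set
TwinTrees {n} φ = Σ (Subgraph n) λ T₁ → Σ (Subgraph n) λ T₂ →
  IsSpanningTree T₁ × IsSpanningTree T₂ × EdgeDisjoint T₁ T₂ ×
  Isomorphic T₁ T₂ × Multicolored φ T₁ × Multicolored φ T₂

module Colouring {n K : ℕ} (φ : EdgeColoring n K) (proper : Proper φ) where

  C : Fin n → Fin n → Fin K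
  C = col φ

  C-sym : ∀ x y → C x y ≡ C y x
  C-sym = symm φ

  edge-by-colour : ∀ v {a b} → a ≢ v → b ≢ v → C v a ≡ C v b → a ≡ b
  edge-by-colour v {a} {b} a≢v b≢v same with a ≟ b
  ... | yes a≡b = a≡b
  ... | no a≢b = contradiction same (proper v a b (≢-sym a≢v) (≢-sym b≢v) a≢b)

  edge-by-colour′ : ∀ v {a b} → a ≢ v → b ≢ v → C a v ≡ C b v → a ≡ b
  edge-by-colour′ v {a} {b} a≢v b≢v same =
    edge-by-colour v a≢v b≢v (trans (C-sym v a) (trans same (C-sym b v)))

  record HookedStar : Set where
    field
      r q₁ q₂ p₁ p₂ : Fin n
      r≢q₁    : r ≢ q₁
      r≢q₂    : r ≢ q₂
      q₁≢q₂   : q₁ ≢ q₂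
      p₁≢q₁   : p₁ ≢ q₁
      p₂≢q₂   : p₂ ≢ q₂
      colour₁ : C q₁ p₁ ≡ C r q₂
      colour₂ : C q₂ p₂ ≡ C r q₁

    -- the remaining separations are forced by properness
    p₁≢r : p₁ ≢ r
    p₁≢r e = q₁≢q₂ (edge-by-colour r (≢-sym r≢q₁) (≢-sym r≢q₂)
                     (trans (C-sym r q₁) (trans (cong (C q₁) (sym e)) colour₁)))

    p₂≢r : p₂ ≢ r
    p₂≢r e = q₁≢q₂ (sym (edge-by-colour r (≢-sym r≢q₂) (≢-sym r≢q₁)
                          (trans (C-sym r q₂) (trans (cong (C q₂) (sym e)) colour₂))))

    p₁≢q₂ : p₁ ≢ q₂
    p₁≢q₂ e = r≢q₁ (sym (edge-by-colour′ q₂ q₁≢q₂ r≢q₂ (trans (cong (C q₁) (sym e)) colour₁)))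

    p₂≢q₁ : p₂ ≢ q₁
    p₂≢q₁ e = r≢q₂ (sym (edge-by-colour′ q₁ (≢-sym q₁≢q₂) r≢q₁ (trans (cong (C q₂) (sym e)) colour₂)))

  module HookedTree (S : HookedStar) where
    open HookedStar S

    data Position (x : Fin n) : Set where
      at-q₁     : x ≡ q₁ → Position x
      at-q₂     : x ≡ q₂ → Position x
      elsewhere : x ≢ q₁ → x ≢ q₂ → Position x

    position : ∀ x → Position x
    position x with x ≟ q₁ | x ≟ q₂
    ... | yes x≡q₁ | _        = at-q₁ x≡q₁
    ... | no _     | yes x≡q₂ = at-q₂ x≡q₂
    ... | no x≢q₁  | no x≢q₂  = elsewhere x≢q₁ x≢q₂

    parent : Fin n → Fin n
    parent x with position x
    ... | at-q₁ _       = p₁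
    ... | at-q₂ _       = p₂
    ... | elsewhere _ _ = r

    parent-q₁ : parent q₁ ≡ p₁
    parent-q₁ with position q₁
    ... | at-q₁ _          = refl
    ... | at-q₂ q₁≡q₂      = contradiction q₁≡q₂ q₁≢q₂
    ... | elsewhere q₁≢q₁ _ = contradiction refl q₁≢q₁

    parent-q₂ : parent q₂ ≡ p₂
    parent-q₂ with position q₂
    ... | at-q₁ q₂≡q₁       = contradiction (sym q₂≡q₁) q₁≢q₂
    ... | at-q₂ _           = refl
    ... | elsewhere _ q₂≢q₂ = contradiction refl q₂≢q₂

    parent-elsewhere : ∀ {x} → x ≢ q₁ → x ≢ q₂ → parent x ≡ r
    parent-elsewhere {x} x≢q₁ x≢q₂ with position x
    ... | at-q₁ x≡q₁    = contradiction x≡q₁ x≢q₁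
    ... | at-q₂ x≡q₂    = contradiction x≡q₂ x≢q₂
    ... | elsewhere _ _ = refl

    parent-among : (P : Fin n → Set) → P p₁ → P p₂ → P r → ∀ x → P (parent x)
    parent-among P at-p₁ at-p₂ at-r x with position x
    ... | at-q₁ _       = at-p₁
    ... | at-q₂ _       = at-p₂
    ... | elsewhere _ _ = at-r

    parent-moves : ∀ x → x ≢ r → parent x ≢ x
    parent-moves x x≢r with position x
    ... | at-q₁ refl = p₁≢q₁
    ... | at-q₂ refl = p₂≢q₂
    ... | elsewhere _ _ = ≢-sym x≢r

    open ParentGraph r parent parent-moves public

    parent-climbs : ∀ x → Star Hangs (parent x) r
    parent-climbs x with position x
    ... | at-q₁ _       = (p₁≢r , parent-elsewhere p₁≢q₁ p₁≢q₂) ◅ ε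
    ... | at-q₂ _       = (p₂≢r , parent-elsewhere p₂≢q₁ p₂≢q₂) ◅ ε
    ... | elsewhere _ _ = ε

    climb : ∀ x → Star Hangs x r
    climb x with x ≟ r
    ... | yes refl = ε
    ... | no x≢r   = (x≢r , refl) ◅ parent-climbs x

    spoke-neighbour : ∀ {x z} → x ≢ r → x ≢ q₁ → x ≢ q₂ → z ≢ q₁ → z ≢ q₂ → Edge graph x z → z ≡ r
    spoke-neighbour x≢r x≢q₁ x≢q₂ z≢q₁ z≢q₂ e with edge-elim e
    ... | inj₁ (_ , px≡z) = trans (sym px≡z) (parent-elsewhere x≢q₁ x≢q₂)
    ... | inj₂ (_ , pz≡x) = contradiction (trans (sym pz≡x) (parent-elsewhere z≢q₁ z≢q₂)) x≢r

    q₁-childless : ∀ y → parent y ≢ q₁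
    q₁-childless = parent-among (_≢ q₁) p₁≢q₁ p₂≢q₁ r≢q₁

    q₂-childless : ∀ y → parent y ≢ q₂
    q₂-childless = parent-among (_≢ q₂) p₁≢q₂ p₂≢q₂ r≢q₂

    -- A cycle avoids the leaves q₁, q₂; a cycle vertex other than r would then have both
    -- cycle neighbours equal to r. But one end of the cycle edge vert 0 – vert 1 is not r.
    acyclic : Acyclic graph
    acyclic cy = [ off-root zero ∘ proj₁ , off-root (suc zero) ∘ proj₁ ] (edge-elim (step zero))
      where
      open Cycle cy
      off-leaf : ∀ {q} → (∀ y → parent y ≢ q) → ∀ i → vert i ≢ q
      off-leaf childless i refl = not-pinned cy i _ (λ j → childless-neighbour childless)

      off-root : ∀ i → vert i ≢ r → ⊥
      off-root i vᵢ≢r = not-pinned cy i r λ j → spoke-neighbour vᵢ≢r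
        (off-leaf q₁-childless i) (off-leaf q₂-childless i) (off-leaf q₁-childless j) (off-leaf q₂-childless j)

    tree : IsSpanningTree graph
    tree = connected climb , acyclic

    -- exchanging q₁ and q₂ matches each tree edge with the spoke at r of the same colour
    exchange : Permutation′ n
    exchange = transpose q₁ q₂

    parent-colour : ∀ x → x ≢ r → C x (parent x) ≡ C r (exchange ⟨$⟩ʳ x)
    parent-colour x x≢r with position x
    ... | at-q₁ refl = trans colour₁ (cong (C r) (sym (transpose-left q₁ q₂)))
    ... | at-q₂ refl = trans colour₂ (cong (C r) (sym (transpose-right q₁ q₂)))
    ... | elsewhere x≢q₁ x≢q₂ = trans (C-sym x r) (cong (C r) (sym (transpose-fixes x≢q₁ x≢q₂)))

    exchange-avoids-r : ∀ x → x ≢ r → exchange ⟨$⟩ʳ x ≢ r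
    exchange-avoids-r x x≢r with position x
    ... | at-q₁ refl = λ e → r≢q₂ (sym (trans (sym (transpose-left q₁ q₂)) e))
    ... | at-q₂ refl = λ e → r≢q₁ (sym (trans (sym (transpose-right q₁ q₂)) e))
    ... | elsewhere x≢q₁ x≢q₂ = λ e → x≢r (trans (sym (transpose-fixes x≢q₁ x≢q₂)) e)

    multicoloured-tree : Multicolored φ graph
    multicoloured-tree = multicoloured φ λ {x} {y} x≢r y≢r same →
      permutation-injective exchange
        (edge-by-colour r (exchange-avoids-r x x≢r) (exchange-avoids-r y y≢r)
          (trans (sym (parent-colour x x≢r)) (trans same (parent-colour y y≢r))))

    data HookEdge (x y : Fin n) : Set where
      spoke : ∀ v → v ≢ r → v ≢ q₁ → v ≢ q₂ → SamePair x y r v → HookEdge x y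
      hook₁ : SamePair x y q₁ p₁ → HookEdge x y
      hook₂ : SamePair x y q₂ p₂ → HookEdge x y

    hook-edge-sym : ∀ {x y} → HookEdge x y → HookEdge y x
    hook-edge-sym (spoke v v≢r v≢q₁ v≢q₂ P) = spoke v v≢r v≢q₁ v≢q₂ (same-pair-sym P)
    hook-edge-sym (hook₁ P) = hook₁ (same-pair-sym P)
    hook-edge-sym (hook₂ P) = hook₂ (same-pair-sym P)

    hanging-edge : ∀ x → x ≢ r → HookEdge x (parent x)
    hanging-edge x x≢r with position x
    ... | at-q₁ refl = hook₁ (straight refl refl)
    ... | at-q₂ refl = hook₂ (straight refl refl)
    ... | elsewhere x≢q₁ x≢q₂ = spoke x x≢r x≢q₁ x≢q₂ (crossed refl refl)

    classify : ∀ {x y} → Edge graph x y → HookEdge x y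
    classify {x} {y} e with edge-elim {x} {y} e
    ... | inj₁ (x≢r , refl) = hanging-edge x x≢r
    ... | inj₂ (y≢r , refl) = hook-edge-sym (hanging-edge y y≢r)

  edge-disjoint : (S T : HookedStar) →
    (∀ {x y} → HookedTree.HookEdge S x y → HookedTree.HookEdge T x y → ⊥) →
    EdgeDisjoint (HookedTree.graph S) (HookedTree.graph T)
  edge-disjoint S T clash u v e =
    ¬-not λ e′ → clash (HookedTree.classify S {u} {v} e) (HookedTree.classify T {u} {v} e′)

  record Carries (σ : Permutation′ n) (S T : HookedStar) : Set where
    field
      r↦  : σ ⟨$⟩ʳ HookedStar.r S  ≡ HookedStar.r T
      q₁↦ : σ ⟨$⟩ʳ HookedStar.q₁ S ≡ HookedStar.q₁ T
      q₂↦ : σ ⟨$⟩ʳ HookedStar.q₂ S ≡ HookedStar.q₂ T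
      p₁↦ : σ ⟨$⟩ʳ HookedStar.p₁ S ≡ HookedStar.p₁ T
      p₂↦ : σ ⟨$⟩ʳ HookedStar.p₂ S ≡ HookedStar.p₂ T

  hooked-iso : ∀ {S T} (σ : Permutation′ n) → Carries σ S T →
               Isomorphic (HookedTree.graph S) (HookedTree.graph T)
  hooked-iso {S} {T} σ carries =
    parent-graph-iso {moves = S.parent-moves} {moves′ = T.parent-moves} σ r↦ commutes
    where
    open Carries carries
    module S = HookedTree S
    module T = HookedTree T

    commutes : ∀ x → x ≢ HookedStar.r S → T.parent (σ ⟨$⟩ʳ x) ≡ σ ⟨$⟩ʳ S.parent x
    commutes x _ with S.position x
    ... | S.at-q₁ refl = trans (cong T.parent q₁↦) (trans T.parent-q₁ (sym p₁↦))
    ... | S.at-q₂ refl = trans (cong T.parent q₂↦) (trans T.parent-q₂ (sym p₂↦))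
    ... | S.elsewhere x≢q₁ x≢q₂ = trans (T.parent-elsewhere (away x≢q₁ q₁↦) (away x≢q₂ q₂↦)) (sym r↦)
      where
      away : ∀ {a b} → x ≢ a → σ ⟨$⟩ʳ a ≡ b → σ ⟨$⟩ʳ x ≢ b
      away x≢a σa≡b e = x≢a (permutation-injective σ (trans e (sym σa≡b)))

  twins : (S T : HookedStar) →
    (∀ {x y} → HookedTree.HookEdge S x y → HookedTree.HookEdge T x y → ⊥) →
    (σ : Permutation′ n) → Carries σ S T → TwinTrees φ
  twins S T clash σ carries =
    S.graph , T.graph , S.tree , T.tree , edge-disjoint S T clash , hooked-iso σ carries ,
    S.multicoloured-tree , T.multicoloured-tree
    where
    module S = HookedTree S
    module T = HookedTree T

-- In a proper colouring of K_{K+1} with K colours every colour occurs at every vertex: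
-- otherwise the colours at v, with the missing colour put at v, would inject K+1 into K.
colour-occurs : ∀ {K} (φ : EdgeColoring (suc K) K) → Proper φ →
                ∀ v k → ∃ λ w → w ≢ v × col φ v w ≡ k
colour-occurs {K} φ proper v k with any? (λ w → ¬? (w ≟ v) ×-dec (col φ v w ≟ k))
... | yes found  = found
... | no missing = ⊥-elim (<⇒notInjective (n<1+n K) (λ {w} {w′} → recolour-injective {w} {w′}))
  where
  open Colouring φ proper using (edge-by-colour)

  recolour : Fin (suc K) → Fin K
  recolour w with w ≟ v
  ... | yes _ = k
  ... | no _  = col φ v w

  recolour-injective : Injective _≡_ _≡_ recolour
  recolour-injective {w} {w′} same with w ≟ v | w′ ≟ v
  ... | yes refl | yes refl = refl
  ... | yes _    | no w′≢v  = contradiction (w′ , w′≢v , sym same) missing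
  ... | no w≢v   | yes _    = contradiction (w , w≢v , same) missing
  ... | no w≢v   | no w′≢v  = edge-by-colour v w≢v w′≢v same

module OneFactorisation {K : ℕ} (φ : EdgeColoring (suc K) K) (proper : Proper φ) where
  open Colouring φ proper
  open HookedTree using (HookEdge; spoke; hook₁; hook₂)

  mate : Fin (suc K) → Fin K → Fin (suc K)
  mate v k = proj₁ (colour-occurs φ proper v k)

  mate-≢ : ∀ v k → mate v k ≢ v
  mate-≢ v k = proj₁ (proj₂ (colour-occurs φ proper v k))

  mate-colour : ∀ v k → C v (mate v k) ≡ k
  mate-colour v k = proj₂ (proj₂ (colour-occurs φ proper v k))

  mate-unique : ∀ {v z k} → z ≢ v → C v z ≡ k → z ≡ mate v k
  mate-unique {v} {z} {k} z≢v colour =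
    edge-by-colour v z≢v (mate-≢ v k) (trans colour (sym (mate-colour v k)))

  -- The corner q – p – s closes when q and s have a common mate t across the colours of
  -- the opposite edges, i.e. q p s t is a square whose opposite edges have equal colours.
  Closes : Fin (suc K) → Fin (suc K) → Fin (suc K) → Set
  Closes p q s = mate q (C p s) ≡ mate s (C p q)

  closes? : ∀ p q s → Dec (Closes p q s)
  closes? p q s = mate q (C p s) ≟ mate s (C p q)

  -- An open corner q – p – s gives twin hooked stars: T₁ at p re-hangs q and s onto their
  -- mates s′ and y, T₂ at q re-hangs p and s′ onto s and y′; σ = (s s′)(p q)(y y′).
  module OpenCorner (p q s : Fin (suc K)) (p≢q : p ≢ q) (p≢s : p ≢ s) (q≢s : q ≢ s)
                    (open-corner : ¬ Closes p q s) where
    s′ y y′ : Fin (suc K)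
    s′ = mate q (C p s)
    y  = mate s (C p q)
    y′ = mate s′ (C p q)

    T₁ : HookedStar
    T₁ = record
      { r = p ; q₁ = q ; q₂ = s ; p₁ = s′ ; p₂ = y
      ; r≢q₁ = p≢q ; r≢q₂ = p≢s ; q₁≢q₂ = q≢s ; p₁≢q₁ = mate-≢ q _ ; p₂≢q₂ = mate-≢ s _
      ; colour₁ = mate-colour q _ ; colour₂ = mate-colour s _ }
    module T₁ = HookedStar T₁

    T₂ : HookedStar
    T₂ = record
      { r = q ; q₁ = p ; q₂ = s′ ; p₁ = s ; p₂ = y′
      ; r≢q₁ = ≢-sym p≢q ; r≢q₂ = ≢-sym (mate-≢ q _) ; q₁≢q₂ = ≢-sym T₁.p₁≢r
      ; p₁≢q₁ = ≢-sym p≢s ; p₂≢q₂ = mate-≢ s′ _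
      ; colour₁ = sym (mate-colour q _) ; colour₂ = trans (mate-colour s′ _) (C-sym p q) }
    module T₂ = HookedStar T₂

    -- were y′ = s, then s′ would be the mate of s in the colour of p q, i.e. s′ = y
    y′≢s : y′ ≢ s
    y′≢s e = open-corner (mate-unique T₁.p₁≢q₂
               (trans (C-sym s s′) (trans (cong (C s′) (sym e)) (mate-colour s′ _))))

    disjoint : ∀ {x z} → HookEdge T₁ x z → HookEdge T₂ x z → ⊥
    disjoint (spoke _ _ _ v≢s P) (spoke _ _ v′≢p _ P′) = pair-clash P P′ (by-first p≢q) (by-first (≢-sym v′≢p))
    disjoint (spoke _ _ _ v≢s P) (hook₁ P′)           = pair-clash P P′ (by-second v≢s) (by-first p≢s)
    disjoint (spoke _ _ _ _ P)   (hook₂ P′)           = pair-clash P P′ (by-first (≢-sym T₁.p₁≢r)) (by-first (≢-sym T₂.p₂≢q₁))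
    disjoint (hook₁ P) (spoke _ v′≢q _ v′≢s′ P′)      = pair-clash P P′ (by-second (≢-sym v′≢s′)) (by-first (≢-sym v′≢q))
    disjoint (hook₁ P) (hook₁ P′)                     = pair-clash P P′ (by-first (≢-sym p≢q)) (by-first q≢s)
    disjoint (hook₁ P) (hook₂ P′)                     = pair-clash P P′ (by-first (≢-sym T₁.p₁≢q₁)) (by-first (≢-sym T₂.p₂≢r))
    disjoint (hook₂ P) (spoke _ _ _ _ P′)             = pair-clash P P′ (by-first (≢-sym q≢s)) (by-second T₁.p₂≢q₁)
    disjoint (hook₂ P) (hook₁ P′)                     = pair-clash P P′ (by-first (≢-sym p≢s)) (by-second T₁.p₂≢r)
    disjoint (hook₂ P) (hook₂ P′)                     = pair-clash P P′ (by-first (≢-sym T₁.p₁≢q₂)) (by-first (≢-sym y′≢s))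

    σ : Permutation′ (suc K)
    σ = transpose s s′ ∘ₚ transpose p q ∘ₚ transpose y y′

    σ-at : ∀ t {t₁ t₂ t₃} → transpose s s′ ⟨$⟩ʳ t ≡ t₁ → transpose p q ⟨$⟩ʳ t₁ ≡ t₂ →
           transpose y y′ ⟨$⟩ʳ t₂ ≡ t₃ → σ ⟨$⟩ʳ t ≡ t₃
    σ-at t e₁ e₂ e₃ = trans (cong (λ z → transpose y y′ ⟨$⟩ʳ (transpose p q ⟨$⟩ʳ z)) e₁)
                            (trans (cong (transpose y y′ ⟨$⟩ʳ_) e₂) e₃)

    carries : Carries σ T₁ T₂
    carries = record
      { r↦  = σ-at p (transpose-fixes p≢s (≢-sym T₁.p₁≢r)) (transpose-left p q)
                     (transpose-fixes (≢-sym T₁.p₂≢q₁) (≢-sym T₂.p₂≢r))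
      ; q₁↦ = σ-at q (transpose-fixes q≢s (≢-sym T₁.p₁≢q₁)) (transpose-right p q)
                     (transpose-fixes (≢-sym T₁.p₂≢r) (≢-sym T₂.p₂≢q₁))
      ; q₂↦ = σ-at s (transpose-left s s′) (transpose-fixes T₁.p₁≢r T₁.p₁≢q₁)
                     (transpose-fixes open-corner (≢-sym T₂.p₂≢q₂))
      ; p₁↦ = σ-at s′ (transpose-right s s′) (transpose-fixes (≢-sym p≢s) (≢-sym q≢s))
                      (transpose-fixes (≢-sym T₁.p₂≢q₂) (≢-sym y′≢s))
      ; p₂↦ = σ-at y (transpose-fixes T₁.p₂≢q₂ (≢-sym open-corner)) (transpose-fixes T₁.p₂≢r T₁.p₂≢q₁)
                     (transpose-left y y′)
      }

    twin-stars : TwinTrees φ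
    twin-stars = twins T₁ T₂ disjoint σ carries

  -- The corners at u spanned by three further vertices w, a, b and by c, the mate of w in
  -- the colour of u a. If the corners a – u – w, a – u – b and w – u – c all close, then the
  -- stars at u and at w, re-hung along these squares, are twins; otherwise a corner is open.
  module Corner (u w a : Fin (suc K)) (u≢w : u ≢ w) (u≢a : u ≢ a) (w≢a : w ≢ a) where
    c : Fin (suc K)
    c = mate w (C u a)

    c≢w : c ≢ w
    c≢w = mate-≢ w _

    c≢u : c ≢ u
    c≢u e = w≢a (edge-by-colour u (≢-sym u≢w) (≢-sym u≢a)
                  (trans (C-sym u w) (trans (cong (C w) (sym e)) (mate-colour w _))))

    c≢a : c ≢ a
    c≢a e = u≢w (sym (edge-by-colour′ a w≢a u≢a (trans (cong (C w) (sym e)) (mate-colour w _))))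

    -- T₁ at u re-hangs a and b onto x, the common mate closing a – u – b;
    -- T₂ at w re-hangs u and c onto a; σ = (u w)(u x)(u a)(b c).
    module AllClosed (b : Fin (suc K)) (u≢b : u ≢ b) (w≢b : w ≢ b) (a≢b : a ≢ b) (b≢c : b ≢ c)
                     (closes-a-w : Closes u a w) (closes-a-b : Closes u a b) (closes-w-c : Closes u w c) where
      x : Fin (suc K)
      x = mate a (C u b)

      ac-colour : C a c ≡ C u w
      ac-colour = trans (cong (C a) (sym closes-a-w)) (mate-colour a _)

      bx-colour : C b x ≡ C u a
      bx-colour = trans (cong (C b) closes-a-b) (mate-colour b _)

      wa-colour : C w a ≡ C u c
      wa-colour = trans (cong (C w) (trans a-is-mate (sym closes-w-c))) (mate-colour w _)
        where
        a-is-mate : a ≡ mate c (C u w)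
        a-is-mate = mate-unique (≢-sym c≢a) (trans (C-sym c a) ac-colour)

      x≢b : x ≢ b
      x≢b e = u≢a (sym (edge-by-colour′ b a≢b u≢b (trans (cong (C a) (sym e)) (mate-colour a _))))

      x≢w : x ≢ w
      x≢w e = b≢c (sym (edge-by-colour u c≢u (≢-sym u≢b)
                (trans (sym wa-colour) (trans (C-sym w a) (trans (cong (C a) (sym e)) (mate-colour a _))))))

      x≢c : x ≢ c
      x≢c e = w≢b (edge-by-colour u (≢-sym u≢w) (≢-sym u≢b)
                (trans (sym ac-colour) (trans (cong (C a) (sym e)) (mate-colour a _))))

      T₁ : HookedStar
      T₁ = record
        { r = u ; q₁ = a ; q₂ = b ; p₁ = x ; p₂ = x
        ; r≢q₁ = u≢a ; r≢q₂ = u≢b ; q₁≢q₂ = a≢b ; p₁≢q₁ = mate-≢ a _ ; p₂≢q₂ = x≢b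
        ; colour₁ = mate-colour a _ ; colour₂ = bx-colour }
      module T₁ = HookedStar T₁

      T₂ : HookedStar
      T₂ = record
        { r = w ; q₁ = u ; q₂ = c ; p₁ = a ; p₂ = a
        ; r≢q₁ = ≢-sym u≢w ; r≢q₂ = ≢-sym c≢w ; q₁≢q₂ = ≢-sym c≢u ; p₁≢q₁ = ≢-sym u≢a ; p₂≢q₂ = ≢-sym c≢a
        ; colour₁ = sym (mate-colour w _) ; colour₂ = trans (C-sym c a) (trans ac-colour (C-sym u w)) }

      disjoint : ∀ {y z} → HookEdge T₁ y z → HookEdge T₂ y z → ⊥
      disjoint (spoke _ _ _ _ P) (spoke _ _ v′≢u _ P′) = pair-clash P P′ (by-first u≢w) (by-first (≢-sym v′≢u))
      disjoint (spoke _ _ v≢a _ P) (hook₁ P′)         = pair-clash P P′ (by-second v≢a) (by-first u≢a)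
      disjoint (spoke _ _ _ _ P) (hook₂ P′)           = pair-clash P P′ (by-first (≢-sym c≢u)) (by-first u≢a)
      disjoint (hook₁ P) (spoke _ _ _ _ P′)           = pair-clash P P′ (by-first (≢-sym w≢a)) (by-second x≢w)
      disjoint (hook₁ P) (hook₁ P′)                   = pair-clash P P′ (by-first (≢-sym u≢a)) (by-second T₁.p₁≢r)
      disjoint (hook₁ P) (hook₂ P′)                   = pair-clash P P′ (by-first (≢-sym c≢a)) (by-second x≢c)
      disjoint (hook₂ P) (spoke _ _ _ _ P′)           = pair-clash P P′ (by-first (≢-sym w≢b)) (by-second x≢w)
      disjoint (hook₂ P) (hook₁ P′)                   = pair-clash P P′ (by-first (≢-sym u≢b)) (by-first (≢-sym a≢b))
      disjoint (hook₂ P) (hook₂ P′)                   = pair-clash P P′ (by-first b≢c) (by-first (≢-sym a≢b))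

      σ : Permutation′ (suc K)
      σ = transpose u w ∘ₚ transpose u x ∘ₚ transpose u a ∘ₚ transpose b c

      σ-at : ∀ t {t₁ t₂ t₃ t₄} → transpose u w ⟨$⟩ʳ t ≡ t₁ → transpose u x ⟨$⟩ʳ t₁ ≡ t₂ →
             transpose u a ⟨$⟩ʳ t₂ ≡ t₃ → transpose b c ⟨$⟩ʳ t₃ ≡ t₄ → σ ⟨$⟩ʳ t ≡ t₄
      σ-at t e₁ e₂ e₃ e₄ =
        trans (cong (λ z → transpose b c ⟨$⟩ʳ (transpose u a ⟨$⟩ʳ (transpose u x ⟨$⟩ʳ z))) e₁)
          (trans (cong (λ z → transpose b c ⟨$⟩ʳ (transpose u a ⟨$⟩ʳ z)) e₂)
            (trans (cong (transpose b c ⟨$⟩ʳ_) e₃) e₄))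

      x↦a : σ ⟨$⟩ʳ x ≡ a
      x↦a = σ-at x (transpose-fixes T₁.p₁≢r x≢w) (transpose-right u x) (transpose-left u a)
                   (transpose-fixes a≢b (≢-sym c≢a))

      carries : Carries σ T₁ T₂
      carries = record
        { r↦  = σ-at u (transpose-left u w) (transpose-fixes (≢-sym u≢w) (≢-sym x≢w))
                       (transpose-fixes (≢-sym u≢w) w≢a) (transpose-fixes w≢b (≢-sym c≢w))
        ; q₁↦ = σ-at a (transpose-fixes (≢-sym u≢a) (≢-sym w≢a)) (transpose-fixes (≢-sym u≢a) (≢-sym (mate-≢ a _)))
                       (transpose-right u a) (transpose-fixes u≢b (≢-sym c≢u))
        ; q₂↦ = σ-at b (transpose-fixes (≢-sym u≢b) (≢-sym w≢b)) (transpose-fixes (≢-sym u≢b) (≢-sym x≢b))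
                       (transpose-fixes (≢-sym u≢b) (≢-sym a≢b)) (transpose-left b c)
        ; p₁↦ = x↦a
        ; p₂↦ = x↦a
        }

      twin-stars : TwinTrees φ
      twin-stars = twins T₁ T₂ disjoint σ carries

    twins-with : ∀ b → u ≢ b → w ≢ b → a ≢ b → b ≢ c → TwinTrees φ
    twins-with b u≢b w≢b a≢b b≢c with closes? u a w | closes? u a b | closes? u w c
    ... | no opens-a-w | _ | _ = OpenCorner.twin-stars u a w u≢a u≢w (≢-sym w≢a) opens-a-w
    ... | yes _ | no opens-a-b | _ = OpenCorner.twin-stars u a b u≢a u≢b a≢b opens-a-b
    ... | yes _ | yes _ | no opens-w-c = OpenCorner.twin-stars u w c u≢w (≢-sym c≢u) (≢-sym c≢w) opens-w-c
    ... | yes closes-a-w | yes closes-a-b | yes closes-w-c =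
      AllClosed.twin-stars b u≢b w≢b a≢b b≢c closes-a-w closes-a-b closes-w-c

  -- Five distinct vertices suffice: of the last two, at least one differs from c.
  twins-among-five : (v : Fin 5 → Fin (suc K)) → Injective _≡_ _≡_ v → TwinTrees φ
  twins-among-five v v-injective = pick (v 3F ≟ c)
    where
    apart : ∀ {i j} → i ≢ j → v i ≢ v j
    apart i≢j = i≢j ∘ v-injective

    open Corner (v 0F) (v 1F) (v 2F) (apart λ ()) (apart λ ()) (apart λ ())

    pick : Dec (v 3F ≡ c) → TwinTrees φ
    pick (no v₃≢c)  = twins-with (v 3F) (apart λ ()) (apart λ ()) (apart λ ()) v₃≢c
    pick (yes v₃≡c) = twins-with (v 4F) (apart λ ()) (apart λ ()) (apart λ ())
                        (λ v₄≡c → apart (λ ()) (trans v₃≡c (sym v₄≡c)))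

  twin-trees : 5 ≤ suc K → TwinTrees φ
  twin-trees 5≤n = twins-among-five (λ i → inject≤ i 5≤n) (inject≤-injective _ _ _ _)

lemma5 : (m : ℕ) → m ≥ 3 → (φ : EdgeColoring (2 * m) (2 * m ∸ 1)) → Proper φ →
    Σ (Subgraph (2 * m)) λ T₁ → Σ (Subgraph (2 * m)) λ T₂ →
      IsSpanningTree T₁ × IsSpanningTree T₂ × EdgeDisjoint T₁ T₂ ×
      Isomorphic T₁ T₂ × Multicolored φ T₁ × Multicolored φ T₂
lemma5 m m≥3@(s≤s (s≤s (s≤s _))) φ proper =
  OneFactorisation.twin-trees φ proper (≤-trans (n≤1+n 5) (*-monoʳ-≤ 2 m≥3))
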